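{- Let $G$ be a connected chain graph with at least three vertices. If every non-pendant vertex of $G$ is adjacent to a pendant vertex and also to a non-pendant vertex, then $G$ is a bi-star.
   Context: All graphs are finite and simple. A bipartite graph $G=(X,Y,E)$ is a chain graph if the vertices of $X$ can be ordered $x_1,\dots,x_p$ with $N_G(x_1)\subseteq\cdots\subseteq N_G(x_p)$. A pendant vertex is a vertex of degree 1. A bi-star is a tree with exactly two non-pendant vertices (two adjacent centers, each adjacent to at least one pendant vertex). -}

module Defs where

open import Data.Nat using (ℕ; zero; suc; _+_; _≤_)
open import Data.Bool using (Bool; true; false; if_then_else_)
open import Data.Fin as Fin using (Fin; inject₁; fromℕ)
open import Data.List using (List; map; allFin)
open import Data.Nat.ListAction using (sum)
open import Data.Product using (Σ; ∃; ∃-syntax; _×_; _,_)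
open import Data.Sum using (_⊎_)
open import Relation.Binary.PropositionalEquality using (_≡_; _≢_)
open import Relation.Nullary using (¬_)
open import Function.Definitions using (Injective)

record Graph : Set where
  field
    n     : ℕ
    adj   : Fin n → Fin n → Bool
    sym   : ∀ u v → adj u v ≡ adj v u
    irrefl : ∀ u → adj u u ≡ false

open Graph public

Adj : (G : Graph) → Fin (n G) → Fin (n G) → Set
Adj G u v = adj G u v ≡ true

degree : (G : Graph) → Fin (n G) → ℕ
degree G u = sum (map (λ v → if adj G u v then 1 else 0) (allFin (n G)))

Pendant : (G : Graph) → Fin (n G) → Set
Pendant G u = degree G u ≡ 1

NonPendant : (G : Graph) → Fin (n G) → Set
NonPendant G u = ¬ Pendant G u

data Walk (G : Graph) : Fin (n G) → Fin (n G) → Set where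
  here : ∀ {u} → Walk G u u
  step : ∀ {u w v} → Adj G u w → Walk G w v → Walk G u v

Connected : Graph → Set
Connected G = ∀ u v → Walk G u v

-- A cycle: k ≥ 3 distinct vertices c 0, …, c (k-1), consecutive ones adjacent
-- and c (k-1) adjacent to c 0.
HasCycle : Graph → Set
HasCycle G = Σ ℕ λ m → Σ (Fin (suc (suc (suc m))) → Fin (n G)) λ c →
  Injective _≡_ _≡_ c ×
  (∀ (i : Fin (suc (suc m))) → Adj G (c (inject₁ i)) (c (Fin.suc i))) ×
  Adj G (c (fromℕ (suc (suc m)))) (c Fin.zero)

IsTree : Graph → Set
IsTree G = Connected G × ¬ HasCycle G

-- Bipartite graph G = (X, Y, E): side v ≡ true means v ∈ X, false means v ∈ Y;
-- every edge joins X and Y.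
IsBipartition : (G : Graph) → (Fin (n G) → Bool) → Set
IsBipartition G side = ∀ u v → Adj G u v → side u ≢ side v

IsChainGraph : Graph → Set
IsChainGraph G = Σ (Fin (n G) → Bool) λ side → IsBipartition G side ×
  Σ ℕ λ p → Σ (Fin p → Fin (n G)) λ x →
    Injective _≡_ _≡_ x ×
    (∀ v → side v ≡ true → ∃[ i ] x i ≡ v) ×
    (∀ i → side (x i) ≡ true) ×
    (∀ i j → Fin.toℕ i ≤ Fin.toℕ j → ∀ w → Adj G (x i) w → Adj G (x j) w)

IsBiStar : Graph → Set
IsBiStar G = IsTree G × Σ (Fin (n G)) λ a → Σ (Fin (n G)) λ b →
  a ≢ b × Adj G a b × NonPendant G a × NonPendant G b ×
  (∀ v → NonPendant G v → v ≡ a ⊎ v ≡ b) ×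
  (∃[ u ] (Adj G a u × Pendant G u)) ×
  (∃[ u ] (Adj G b u × Pendant G u))

-- In a chain graph the neighbourhoods of the X-side are nested, so the X-vertex
-- a with the largest neighbourhood sees every neighbour of every X-vertex.  A
-- pendant vertex has only one neighbour; hence an X-vertex with a pendant
-- neighbour u must be a (as u is also adjacent to a), and of two Y-vertices with
-- pendant neighbours u₁, u₂, the one of u₁, u₂ with the larger neighbourhood is
-- adjacent to both, so they coincide.  Thus there are at most two non-pendant
-- vertices, a and its non-pendant neighbour b.  A cycle would contain three
-- non-pendant vertices, so G is a tree, and a itself is non-pendant since
-- otherwise G would be a single edge.
module Submission where

open import Defs
open import Data.Nat using (_≤_)
open import Data.Product using (∃-syntax; _×_)

open import Data.Bool using (Bool; true; false; if_then_else_; not)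
open import Data.Bool.Properties using (¬-not)
open import Data.Empty using (⊥-elim)
open import Data.Fin using (Fin; zero; suc; fromℕ; toℕ; inject₁)
open import Data.Fin.Properties using (≤fromℕ) renaming (_≟_ to _≟ᶠ_)
open import Data.List using (tabulate)
open import Data.List.Properties using (map-tabulate)
open import Data.Nat as ℕ using (ℕ; _+_; s≤s)
open import Data.Nat.ListAction using (sum)
open import Data.Nat.Properties using (≤-total; ≤-trans; n≤1+n; module ≤-Reasoning; m≤m+n; m≤n+m; +-monoʳ-≤; +-comm)
open import Data.Product using (_,_; proj₁; proj₂)
open import Data.Sum using (_⊎_; inj₁; inj₂)
open import Data.Unit using (⊤; tt)
open import Relation.Nullary using (¬_; yes; no)
open import Relation.Binary.PropositionalEquality using (_≡_; _≢_; refl; trans; cong; cong₂; subst)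
import Relation.Binary.PropositionalEquality as ≡

record ThreeDistinct {A : Set} (P : A → Set) : Set where
  constructor distinct
  field
    {a b c} : A
    a≢b     : a ≢ b
    a≢c     : a ≢ c
    b≢c     : b ≢ c
    Pa      : P a
    Pb      : P b
    Pc      : P c

ThreeDistinct⇒¬⊆pair : ∀ {A : Set} {P : A → Set} {p q : A} →
  ThreeDistinct P → ¬ (∀ v → P v → v ≡ p ⊎ v ≡ q)
ThreeDistinct⇒¬⊆pair (distinct a≢b a≢c b≢c Pa Pb Pc) ⊆pair
  with ⊆pair _ Pa | ⊆pair _ Pb | ⊆pair _ Pc
... | inj₁ a≡p | inj₁ b≡p | _        = a≢b (trans a≡p (≡.sym b≡p))
... | inj₂ a≡q | inj₂ b≡q | _        = a≢b (trans a≡q (≡.sym b≡q))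
... | inj₁ a≡p | inj₂ _   | inj₁ c≡p = a≢c (trans a≡p (≡.sym c≡p))
... | inj₁ _   | inj₂ b≡q | inj₂ c≡q = b≢c (trans b≡q (≡.sym c≡q))
... | inj₂ _   | inj₁ b≡p | inj₁ c≡p = b≢c (trans b≡p (≡.sym c≡p))
... | inj₂ a≡q | inj₁ _   | inj₂ c≡q = a≢c (trans a≡q (≡.sym c≡q))

Fin-ThreeDistinct : ∀ {k} → 3 ≤ k → ThreeDistinct {Fin k} (λ _ → ⊤)
Fin-ThreeDistinct (s≤s (s≤s (s≤s _))) =
  distinct {a = zero} {suc zero} {suc (suc zero)} (λ ()) (λ ()) (λ ()) tt tt tt

Fin-other : ∀ {k} → 2 ≤ k → (u : Fin k) → ∃[ v ] u ≢ v
Fin-other (s≤s (s≤s _)) zero    = suc zero , λ ()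
Fin-other (s≤s (s≤s _)) (suc u) = zero , λ ()

≤-sum-tabulate : ∀ {k} (h : Fin k → ℕ) (v : Fin k) → h v ≤ sum (tabulate h)
≤-sum-tabulate h zero    = m≤m+n (h zero) _
≤-sum-tabulate h (suc v) = ≤-trans (≤-sum-tabulate (λ i → h (suc i)) v) (m≤n+m _ (h zero))

+-≤-sum-tabulate : ∀ {k} (h : Fin k → ℕ) {v w : Fin k} → v ≢ w →
  h v + h w ≤ sum (tabulate h)
+-≤-sum-tabulate h {zero}  {zero}  v≢w = ⊥-elim (v≢w refl)
+-≤-sum-tabulate h {zero}  {suc w} _   =
  +-monoʳ-≤ (h zero) (≤-sum-tabulate (λ i → h (suc i)) w)
+-≤-sum-tabulate h {suc v} {zero}  _   =
  subst (_≤ sum (tabulate h)) (+-comm (h zero) (h (suc v)))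
    (+-monoʳ-≤ (h zero) (≤-sum-tabulate (λ i → h (suc i)) v))
+-≤-sum-tabulate h {suc v} {suc w} v≢w =
  ≤-trans (+-≤-sum-tabulate (λ i → h (suc i)) (λ v≡w → v≢w (cong suc v≡w)))
          (m≤n+m _ (h zero))

module _ (G : Graph) where

  private
    V = Fin (n G)

  Adj-sym : ∀ {u v : V} → Adj G u v → Adj G v u
  Adj-sym {u} {v} = trans (Graph.sym G v u)

  Pendant? : (v : V) → Pendant G v ⊎ NonPendant G v
  Pendant? v with degree G v ℕ.≟ 1
  ... | yes p = inj₁ p
  ... | no np = inj₂ np

  degree≡sum-tabulate : ∀ u → degree G u ≡ sum (tabulate (λ v → if adj G u v then 1 else 0))
  degree≡sum-tabulate u = cong sum (map-tabulate (λ v → v) (λ v → if adj G u v then 1 else 0))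

  two-neighbours⇒2≤degree : ∀ {u v w} → Adj G u v → Adj G u w → v ≢ w → 2 ≤ degree G u
  two-neighbours⇒2≤degree {u} {v} {w} uv uw v≢w = begin
    1 + 1                      ≡⟨ cong₂ _+_ (indicator-Adj uv) (indicator-Adj uw) ⟨
    indicator v + indicator w  ≤⟨ +-≤-sum-tabulate indicator v≢w ⟩
    sum (tabulate indicator)   ≡⟨ degree≡sum-tabulate u ⟨
    degree G u                 ∎
    where
    open ≤-Reasoning

    indicator : V → ℕ
    indicator t = if adj G u t then 1 else 0

    indicator-Adj : ∀ {t} → Adj G u t → indicator t ≡ 1
    indicator-Adj = cong (λ b → if b then 1 else 0)

  two-neighbours⇒NonPendant : ∀ {u v w} → Adj G u v → Adj G u w → v ≢ w → NonPendant G u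
  two-neighbours⇒NonPendant uv uw v≢w deg≡1
    with subst (2 ≤_) deg≡1 (two-neighbours⇒2≤degree uv uw v≢w)
  ... | s≤s ()

  Pendant⇒neighbour-unique : ∀ {u v w} → Pendant G u → Adj G u v → Adj G u w → v ≡ w
  Pendant⇒neighbour-unique {v = v} {w} pu uv uw with v ≟ᶠ w
  ... | yes v≡w = v≡w
  ... | no v≢w  = ⊥-elim (two-neighbours⇒NonPendant uv uw v≢w pu)

  Connected⇒neighbour : Connected G → 2 ≤ n G → ∀ u → ∃[ w ] Adj G u w
  Connected⇒neighbour conn 2≤n u with Fin-other 2≤n u
  ... | v , u≢v with conn u v
  ...   | here          = ⊥-elim (u≢v refl)
  ...   | step {w = w} uw _ = w , uw

  pendant-edge-closed : ∀ {a b} → Pendant G a → Pendant G b → Adj G a b →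
    ∀ {s t} → Walk G s t → s ≡ a ⊎ s ≡ b → t ≡ a ⊎ t ≡ b
  pendant-edge-closed pa pb ab here                       s∈ab       = s∈ab
  pendant-edge-closed pa pb ab (step sw walk) (inj₁ refl) =
    pendant-edge-closed pa pb ab walk (inj₂ (Pendant⇒neighbour-unique pa sw ab))
  pendant-edge-closed pa pb ab (step sw walk) (inj₂ refl) =
    pendant-edge-closed pa pb ab walk (inj₁ (Pendant⇒neighbour-unique pb sw (Adj-sym ab)))

  Connected⇒¬pendant-edge : Connected G → 3 ≤ n G →
    ∀ {a b} → Pendant G a → Pendant G b → ¬ Adj G a b
  Connected⇒¬pendant-edge conn 3≤n {a} pa pb ab =
    ThreeDistinct⇒¬⊆pair (Fin-ThreeDistinct 3≤n)
      (λ t _ → pendant-edge-closed pa pb ab (conn a t) (inj₁ refl))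

  HasCycle⇒ThreeDistinct-NonPendant : HasCycle G → ThreeDistinct (NonPendant G)
  HasCycle⇒ThreeDistinct-NonPendant (m , c , c-inj , edge , closing) =
    distinct (λ e → 0≢1 (c-inj e)) (λ e → 0≢2 (c-inj e)) (λ e → 1≢2 (c-inj e))
      (two-neighbours⇒NonPendant (edge zero) (Adj-sym closing) (λ e → 1≢last (c-inj e)))
      (two-neighbours⇒NonPendant (Adj-sym (edge zero)) (edge (suc zero)) (λ e → 0≢2 (c-inj e)))
      (NonPendant-c₂ m c c-inj edge closing)
    where
    0≢1 : _≢_ {A = Fin (3 + m)} zero (suc zero)
    0≢1 ()
    0≢2 : _≢_ {A = Fin (3 + m)} zero (suc (suc zero))
    0≢2 ()
    1≢2 : _≢_ {A = Fin (3 + m)} (suc zero) (suc (suc zero))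
    1≢2 ()
    1≢last : suc zero ≢ fromℕ (ℕ.suc (ℕ.suc m))
    1≢last ()

    -- The second neighbour of c 2 is c 3, or c 0 when the cycle is a triangle.
    NonPendant-c₂ : ∀ k (c : Fin (3 + k) → V) → (∀ {i j} → c i ≡ c j → i ≡ j) →
      (∀ i → Adj G (c (inject₁ i)) (c (suc i))) →
      Adj G (c (fromℕ (ℕ.suc (ℕ.suc k)))) (c zero) → NonPendant G (c (suc (suc zero)))
    NonPendant-c₂ ℕ.zero    c c-inj edge closing =
      two-neighbours⇒NonPendant (Adj-sym (edge (suc zero))) closing (λ e → 1≢0 (c-inj e))
      where
      1≢0 : suc zero ≢ zero
      1≢0 ()
    NonPendant-c₂ (ℕ.suc _) c c-inj edge closing =
      two-neighbours⇒NonPendant (Adj-sym (edge (suc zero))) (edge (suc (suc zero)))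
        (λ e → 1≢3 (c-inj e))
      where
      1≢3 : suc zero ≢ suc (suc (suc zero))
      1≢3 ()

  at-most-two-NonPendant⇒¬HasCycle : ∀ {a b} → (∀ v → NonPendant G v → v ≡ a ⊎ v ≡ b) →
    ¬ HasCycle G
  at-most-two-NonPendant⇒¬HasCycle ⊆ab cycle =
    ThreeDistinct⇒¬⊆pair (HasCycle⇒ThreeDistinct-NonPendant cycle) ⊆ab

  _≼_ : V → V → Set
  u ≼ v = ∀ w → Adj G u w → Adj G v w

  ≼-total-on-X : (chain : IsChainGraph G) → ∀ {u v} →
    proj₁ chain u ≡ true → proj₁ chain v ≡ true → u ≼ v ⊎ v ≼ u
  ≼-total-on-X (_ , _ , _ , x , _ , cover , _ , mono) {u} {v} Xu Xv
    with cover u Xu | cover v Xv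
  ... | i , refl | j , refl with ≤-total (toℕ i) (toℕ j)
  ...   | inj₁ i≤j = inj₁ (mono i j i≤j)
  ...   | inj₂ j≤i = inj₂ (mono j i j≤i)

  ≼-maximum-on-X : (chain : IsChainGraph G) → ∀ {u} → proj₁ chain u ≡ true →
    ∃[ a ] proj₁ chain a ≡ true × (∀ v → proj₁ chain v ≡ true → v ≼ a)
  ≼-maximum-on-X (side , _ , _ , x , _ , cover , x-side , mono) {u} Xu =
    x (last (proj₁ (cover u Xu))) , x-side _ , ≼top
    where
    last : ∀ {p} → Fin p → Fin p
    last {ℕ.suc p} _ = fromℕ p

    ≤last : ∀ {p} (i j : Fin p) → toℕ i ≤ toℕ (last j)
    ≤last {ℕ.suc _} i _ = ≤fromℕ i

    ≼top : ∀ v → side v ≡ true → v ≼ x (last (proj₁ (cover u Xu)))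
    ≼top v Xv with cover v Xv
    ... | i , refl = mono i _ (≤last i _)

HasPendantNeighbour : (G : Graph) → Fin (n G) → Set
HasPendantNeighbour G v = ∃[ u ] (Adj G v u × Pendant G u)

HasNonPendantNeighbour : (G : Graph) → Fin (n G) → Set
HasNonPendantNeighbour G v = ∃[ w ] (Adj G v w × NonPendant G w)

module Centres (G : Graph) (chain : IsChainGraph G) (conn : Connected G) (3≤n : 3 ≤ n G)
  (neighbours : ∀ v → NonPendant G v → HasPendantNeighbour G v × HasNonPendantNeighbour G v)
  where

  private
    V = Fin (n G)

    2≤n : 2 ≤ n G
    2≤n = ≤-trans (n≤1+n 2) 3≤n

    v₀ : V
    v₀ = ThreeDistinct.a (Fin-ThreeDistinct 3≤n)

  side : V → Bool
  side = proj₁ chain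

  side-Adj : ∀ {u v} → Adj G u v → side v ≡ not (side u)
  side-Adj uv = ¬-not (proj₁ (proj₂ chain) _ _ (Adj-sym G uv))

  X⇒Adj⇒Y : ∀ {u v} → side u ≡ true → Adj G u v → side v ≡ false
  X⇒Adj⇒Y Xu uv = trans (side-Adj uv) (cong not Xu)

  Y⇒Adj⇒X : ∀ {u v} → side u ≡ false → Adj G u v → side v ≡ true
  Y⇒Adj⇒X Yu uv = trans (side-Adj uv) (cong not Yu)

  some-X : ∃[ v ] side v ≡ true
  some-X with Connected⇒neighbour G conn 2≤n v₀ | side v₀ in side-v₀
  ... | _ , _   | true  = v₀ , side-v₀
  ... | w , v₀w | false = w , Y⇒Adj⇒X side-v₀ v₀w

  a : V
  a = proj₁ (≼-maximum-on-X G chain (proj₂ some-X))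

  X-a : side a ≡ true
  X-a = proj₁ (proj₂ (≼-maximum-on-X G chain (proj₂ some-X)))

  ≼a : ∀ v → side v ≡ true → _≼_ G v a
  ≼a = proj₂ (proj₂ (≼-maximum-on-X G chain (proj₂ some-X)))

  X-NonPendant⇒≡a : ∀ {v} → side v ≡ true → NonPendant G v → v ≡ a
  X-NonPendant⇒≡a {v} Xv npv with proj₁ (neighbours v npv)
  ... | u , vu , pu = Pendant⇒neighbour-unique G pu (Adj-sym G vu) (Adj-sym G (≼a v Xv u vu))

  Y-NonPendant-unique : ∀ {y₁ y₂} → side y₁ ≡ false → side y₂ ≡ false →
    NonPendant G y₁ → NonPendant G y₂ → y₁ ≡ y₂
  Y-NonPendant-unique {y₁} {y₂} Yy₁ Yy₂ np₁ np₂
    with proj₁ (neighbours y₁ np₁) | proj₁ (neighbours y₂ np₂)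
  ... | u₁ , y₁u₁ , pu₁ | u₂ , y₂u₂ , pu₂
    with ≼-total-on-X G chain (Y⇒Adj⇒X Yy₁ y₁u₁) (Y⇒Adj⇒X Yy₂ y₂u₂)
  ...   | inj₁ u₁≼u₂ = Pendant⇒neighbour-unique G pu₂ (u₁≼u₂ y₁ (Adj-sym G y₁u₁)) (Adj-sym G y₂u₂)
  ...   | inj₂ u₂≼u₁ = Pendant⇒neighbour-unique G pu₁ (Adj-sym G y₁u₁) (u₂≼u₁ y₂ (Adj-sym G y₂u₂))

  NonPendant-a : NonPendant G a
  NonPendant-a pa with Connected⇒neighbour G conn 2≤n a
  ... | y , ay with Pendant? G y
  ...   | inj₁ py  = Connected⇒¬pendant-edge G conn 3≤n pa py ay
  ...   | inj₂ npy with proj₂ (neighbours y npy)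
  ...     | w , yw , npw =
    npw (subst (Pendant G) (≡.sym (X-NonPendant⇒≡a (Y⇒Adj⇒X (X⇒Adj⇒Y X-a ay) yw) npw)) pa)

  b : V
  b = proj₁ (proj₂ (neighbours a NonPendant-a))

  a-b : Adj G a b
  a-b = proj₁ (proj₂ (proj₂ (neighbours a NonPendant-a)))

  NonPendant-b : NonPendant G b
  NonPendant-b = proj₂ (proj₂ (proj₂ (neighbours a NonPendant-a)))

  a≢b : a ≢ b
  a≢b a≡b = proj₁ (proj₂ chain) a b a-b (cong side a≡b)

  NonPendant⇒≡a⊎≡b : ∀ v → NonPendant G v → v ≡ a ⊎ v ≡ b
  NonPendant⇒≡a⊎≡b v npv with side v in Yv
  ... | true  = inj₁ (X-NonPendant⇒≡a Yv npv)
  ... | false = inj₂ (Y-NonPendant-unique Yv (X⇒Adj⇒Y X-a a-b) npv NonPendant-b)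

lemma8p2 : (G : Graph) → IsChainGraph G → Connected G → 3 ≤ n G →
    (∀ v → NonPendant G v →
      (∃[ u ] (Adj G v u × Pendant G u)) × (∃[ w ] (Adj G v w × NonPendant G w))) →
    IsBiStar G
lemma8p2 G chain conn 3≤n neighbours =
  (conn , at-most-two-NonPendant⇒¬HasCycle G NonPendant⇒≡a⊎≡b) ,
  a , b , a≢b , a-b , NonPendant-a , NonPendant-b , NonPendant⇒≡a⊎≡b ,
  proj₁ (neighbours a NonPendant-a) , proj₁ (neighbours b NonPendant-b)
  where open Centres G chain conn 3≤n neighbours
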